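{- Let $G$ be a tree rooted at $r$, let $u\in V(G)$, and let $\sigma$ be a configuration that is local terminal in $\mathrm{subtree}(v)$ for every child $v$ of $u$. Let $\psi_u(k)=\sigma_u-k\cdot\deg(u)+\sum_{v\in\mathrm{children}(u)}\delta(v,k)$ and let $k$ be the smallest non-negative integer with $\psi_u(k)<\deg(u)$. Then $\mathbf{c}^{\downarrow}(u)=k$.
   Context: Sandpile on a tree: $\sigma\in\mathbb{N}^{V(G)}$ gives chip counts; vertex $v$ is full if $\sigma_v\ge\deg(v)$; firing $v$ decreases $\sigma_v$ by $\deg(v)$ and adds one chip to each neighbor. $\mathrm{subtree}(v)$ is the vertex set of the subtree rooted at $v$ (including $v$), $\mathrm{parent}(v)$ its parent, $\mathrm{children}(u)$ the children of $u$. A configuration is local terminal in $\mathrm{subtree}(v)$ if $\sigma_w<\deg(w)$ for all $w\in\mathrm{subtree}(v)$. For a configuration $\tau$, $\mathrm{final}(\tau,v)$ is obtained by repeatedly firing full vertices of $\mathrm{subtree}(v)$ until none is full (well defined and order independent), and $\mathbf{c}^{\downarrow}(u)=\mathbf{c}^{\downarrow}(\sigma,u)$ is the number of times $u$ is fired in this process for $\mathrm{subtree}(u)$ starting from $\sigma$. For non-root $v$ and $\sigma$ local terminal in $\mathrm{subtree}(v)$, $\delta(v,x)=\mathrm{final}(\sigma+x e_v,v)_{\mathrm{parent}(v)}-\mathrm{final}(\sigma,v)_{\mathrm{parent}(v)}$ for integers $x\ge 0$, $e_v$ the indicator vector of $v$. -}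

module Defs where

open import Data.Nat using (ℕ; zero; suc; _∸_; _<_; _≤_)
open import Data.Fin using (Fin; _≟_)
open import Data.Bool using (Bool; true; false; if_then_else_; _∨_)
open import Data.Maybe using (Maybe; just; nothing)
open import Data.List using (List; []; _∷_; filter; length)
open import Data.List.Relation.Unary.Any using (Any)
open import Data.Fin.Base using () 
open import Data.Fin using () renaming (toℕ to toℕ)
open import Data.List.Base using ()
open import Data.Product using (Σ; ∃; _×_; _,_)
open import Relation.Binary.PropositionalEquality using (_≡_)
open import Relation.Nullary.Decidable using (⌊_⌋; does)
open import Data.Integer as ℤ using (ℤ; +_)
open import Data.List using () renaming (allFin to allFin)

-- A rooted tree on vertex set Fin n, given by parent pointers.
-- parent v = nothing exactly for the root; every vertex reaches the root
-- by following parent pointers (this forces acyclicity).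

anc : ∀ {n} → (Fin n → Maybe (Fin n)) → ℕ → Fin n → Maybe (Fin n)
anc par zero    v = just v
anc par (suc m) v with par v
... | nothing = nothing
... | just w  = anc par m w

record RootedTree (n : ℕ) : Set where
  field
    parent      : Fin n → Maybe (Fin n)
    root        : Fin n
    root-parent : parent root ≡ nothing
    reaches     : ∀ v → ∃ λ m → anc parent m v ≡ just root

Config : ℕ → Set
Config n = Fin n → ℕ

module _ {n : ℕ} (T : RootedTree n) where
  open RootedTree T

  isParentOf : Fin n → Fin n → Bool
  isParentOf w v with parent w
  ... | nothing = false
  ... | just x  = does (x ≟ v)

  adj : Fin n → Fin n → Bool
  adj v w = isParentOf w v ∨ isParentOf v w

  deg : Fin n → ℕ
  deg v = length (filter (λ w → adj v w ≟ᵇ true) (allFin n))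
    where
      open import Data.Bool.Properties using () renaming (_≟_ to _≟ᵇ_)

  children : Fin n → List (Fin n)
  children u = filter (λ w → isParentOf w u ≟ᵇ true) (allFin n)
    where
      open import Data.Bool.Properties using () renaming (_≟_ to _≟ᵇ_)

  InSubtree : Fin n → Fin n → Set
  InSubtree v w = ∃ λ m → anc parent m w ≡ just v

  Full : Config n → Fin n → Set
  Full τ v = deg v ≤ τ v

  fire : Config n → Fin n → Config n
  fire τ v w with does (w ≟ v)
  ... | true  = τ w ∸ deg v
  ... | false = if adj v w then suc (τ w) else τ w

  data Reach (v : Fin n) : Config n → Config n → List (Fin n) → Set where
    done : ∀ {τ} → Reach v τ τ []
    step : ∀ {τ τ' w ws} → InSubtree v w → Full τ w →
           Reach v (fire τ w) τ' ws → Reach v τ τ' (w ∷ ws)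

  LocalTerminal : Config n → Fin n → Set
  LocalTerminal τ v = ∀ w → InSubtree v w → τ w < deg w

  count : Fin n → List (Fin n) → ℕ
  count u ws = length (filter (λ w → w ≟ u) ws)

  -- τ' = final(τ, v), witnessed by a stabilising firing sequence ws
  -- (final is well defined and order independent, so any witness gives it)
  FinalBy : Fin n → Config n → Config n → List (Fin n) → Set
  FinalBy v τ τ' ws = Reach v τ τ' ws × LocalTerminal τ' v

  IsFinal : Fin n → Config n → Config n → Set
  IsFinal v τ τ' = ∃ λ ws → FinalBy v τ τ' ws

  CDownIs : Config n → Fin n → ℕ → Set
  CDownIs σ u k = ∃ λ τ' → ∃ λ ws → FinalBy u σ τ' ws × count u ws ≡ k

  addAt : Config n → ℕ → Fin n → Config n
  addAt σ x v w with does (w ≟ v)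
  ... | true  = σ w Data.Nat.+ x
  ... | false = σ w

  DeltaIs : Config n → Fin n → ℕ → ℤ → Set
  DeltaIs σ v x d = ∃ λ p → parent v ≡ just p × ∃ λ τ₁ → ∃ λ τ₀ →
    IsFinal v (addAt σ x v) τ₁ × IsFinal v σ τ₀ × d ≡ (+ τ₁ p) ℤ.- (+ τ₀ p)

  data DeltaSumIs (σ : Config n) (x : ℕ) : List (Fin n) → ℤ → Set where
    nil  : DeltaSumIs σ x [] (+ 0)
    cons : ∀ {v vs d s} → DeltaIs σ v x d → DeltaSumIs σ x vs s →
           DeltaSumIs σ x (v ∷ vs) (d ℤ.+ s)

  PsiIs : Config n → Fin n → ℕ → ℤ → Set
  PsiIs σ u k p = ∃ λ s → DeltaSumIs σ k (children u) s ×
    p ≡ (+ σ u) ℤ.- (+ (k Data.Nat.* deg u)) ℤ.+ s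

module Submission where

open import Defs
open import Data.Nat using (ℕ; _<_)
open import Data.Fin using (Fin)
open import Data.Integer as ℤ using (ℤ; +_)
open import Data.List.Membership.Propositional using (_∈_)
open import Data.Product using (∃; _×_)
open import Relation.Nullary using (¬_)

open import Data.Bool using (true; false; if_then_else_)
open import Data.Bool.Properties using (∨-zeroʳ; ∨-comm) renaming (_≟_ to _≟ᵇ_)
open import Data.Empty using (⊥-elim)
open import Data.Fin using (_≟_)
open import Data.Fin.Properties using (any?)
open import Data.Integer using (+<+)
open import Data.Integer.Properties
  using ([+m]-[+n]≡m⊖n; ⊖-≥; pos-+; drop‿+<+; +-commutativeSemigroup)
open import Data.Integer.Tactic.RingSolver using (solve-∀)
open import Algebra.Properties.CommutativeSemigroup +-commutativeSemigroup using (interchange)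
open import Data.List using (List; []; _∷_; _++_; length; filter; allFin; concatMap; map)
open import Data.List.Properties using (filter-accept; filter-reject; filter-++; length-++)
open import Data.List.Membership.Propositional.Properties using (∈-filter⁺; ∈-filter⁻; ∈-allFin)
open import Data.List.Relation.Unary.Any using (here; there)
import Data.List.Relation.Unary.All as All
import Data.List.Relation.Unary.AllPairs as AllPairs
open import Data.List.Relation.Unary.Unique.Propositional using (Unique)
import Data.List.Relation.Unary.Unique.Propositional.Properties as Unique
open import Data.Maybe using (just; nothing)
open import Data.Maybe.Properties using (just-injective) renaming (≡-dec to ≡-decᵐ)
open import Data.Nat using (zero; suc; _+_; _∸_; _*_; _≤_; _≤?_; z≤n; s≤s)
open import Data.Nat.ListAction using (sum)
open import Data.Nat.Properties
  using (+-assoc; +-comm; +-identityʳ; +-cancelˡ-≡; +-cancelʳ-≡; +-∸-assoc; +-∸-comm;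
         m+n∸m≡n; m+n∸n≡m; m+[n∸m]≡n; m≤m+n; m≤n+m; n≤1+n; 1+n≰n;
         ≤-refl; ≤-trans; ≤-antisym; ≤-pred; <⇒≱; ≰⇒>; ≮⇒≥)
open import Data.Product using (_,_; proj₁; proj₂; map₂)
open import Data.Unit using (⊤; tt)
open import Function using (_∘_; id)
open import Relation.Binary.PropositionalEquality
  using (_≡_; _≢_; _≗_; refl; sym; trans; cong; cong₂; cong-app; subst; module ≡-Reasoning)
open import Relation.Nullary using (Dec; yes; no; does)
open import Relation.Nullary.Decidable using (map′; dec-true; dec-false; _×-dec_)
open import Relation.Unary using (Decidable)

-- For k = 0, ψ_u(0) = σ_u < deg u, so nothing in subtree(u) is full.
-- Otherwise ψ_u(0) ≥ deg u makes u full: fire it, then stabilize every child subtree, whose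
-- root v now carries one extra chip; call the result σ'.  These stabilizations exist since
-- ψ_u(k) is defined, so σ + k e_v stabilizes in subtree(v), and then so does the smaller
-- σ + e_v.  By the least action principle the stabilization of σ + (j+1) e_v can begin with
-- that of σ + e_v, hence δ_σ(v, j+1) = δ_σ(v, 1) + δ_σ'(v, j); since u received
-- Σ_v δ_σ(v, 1) chips, ψ_u(j+1) for σ equals ψ_u(j) for σ'.  So k − 1 is the least index
-- for σ', and by induction u fires k − 1 more times after its first firing.

+[m+n]-+m≡+n : ∀ m n → + (m + n) ℤ.- + m ≡ + n
+[m+n]-+m≡+n m n =
  trans ([+m]-[+n]≡m⊖n (m + n) m) (trans (⊖-≥ (m≤m+n m n)) (cong +_ (m+n∸m≡n m n)))

+-regroup : ∀ a b (d s : ℤ) → (+ a ℤ.+ d) ℤ.+ (+ b ℤ.+ s) ≡ + (a + b) ℤ.+ (d ℤ.+ s)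
+-regroup a b d s =
  trans (interchange (+ a) d (+ b) s) (cong (ℤ._+ (d ℤ.+ s)) (sym (pos-+ a b)))

psi-regroupᶻ : ∀ (a c d j s : ℤ) → a ℤ.+ c ℤ.- j ℤ.+ s ≡ d ℤ.+ a ℤ.- (d ℤ.+ j) ℤ.+ (c ℤ.+ s)
psi-regroupᶻ = solve-∀

psi-regroup : ∀ a c d j (s : ℤ) →
              + (a + c) ℤ.- + j ℤ.+ s ≡ + (d + a) ℤ.- + (d + j) ℤ.+ (+ c ℤ.+ s)
psi-regroup a c d j s rewrite pos-+ a c | pos-+ d a | pos-+ d j =
  psi-regroupᶻ (+ a) (+ c) (+ d) (+ j) s

decidable-choice : ∀ {A B : Set} {P : A → Set} (Q : A → B → Set) → B → Decidable P →
                   (∀ {a} → P a → ∃ (Q a)) → ∃ λ (f : A → B) → ∀ {a} → P a → Q a (f a)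
decidable-choice {A} {B} {P} Q default P? h = f , f-spec
  where
  f : A → B
  f a with P? a
  ... | yes pa = proj₁ (h pa)
  ... | no _   = default
  f-spec : ∀ {a} → P a → Q a (f a)
  f-spec {a} pa with P? a
  ... | yes pa' = proj₂ (h pa')
  ... | no ¬pa  = ⊥-elim (¬pa pa)

module Tree {n : ℕ} (T : RootedTree n) where
  open RootedTree T

  anc-parent : ∀ {m x w} → parent x ≡ just w → anc parent (suc m) x ≡ anc parent m w
  anc-parent px rewrite px = refl

  anc-above-root : ∀ m → anc parent (suc m) root ≡ nothing
  anc-above-root m rewrite root-parent = refl

  anc-+ : ∀ m {d w v x} → anc parent m w ≡ just v → anc parent d v ≡ just x →
          anc parent (m + d) w ≡ just x
  anc-+ zero    refl e = e
  anc-+ (suc m) {w = w} e₁ e₂ with parent w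
  anc-+ (suc m) ()      e₂ | nothing
  anc-+ (suc m) e₁      e₂ | just _ = anc-+ m e₁ e₂

  anc-≤-root : ∀ i d {w v} → anc parent i w ≡ just v → anc parent d w ≡ just root → i ≤ d
  anc-≤-root zero    d       _  _  = z≤n
  anc-≤-root (suc i) zero    e₁ refl with () ← trans (sym (anc-above-root i)) e₁
  anc-≤-root (suc i) (suc d) {w} e₁ e₂ with parent w
  anc-≤-root (suc i) (suc d) () e₂ | nothing
  anc-≤-root (suc i) (suc d) e₁ e₂ | just _ = s≤s (anc-≤-root i d e₁ e₂)

  anc-last : ∀ m {w u} → anc parent (suc m) w ≡ just u →
             ∃ λ v → anc parent m w ≡ just v × parent v ≡ just u
  anc-last m {w} e with parent w in pw
  anc-last m       ()     | nothing
  anc-last zero    {w} e  | just _ = w , refl , trans pw e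
  anc-last (suc m) e      | just _ with anc-last m e
  ... | v , e' , pv = v , trans (anc-parent pw) e' , pv

  depth : Fin n → ℕ
  depth w = proj₁ (reaches w)

  depth-anc : ∀ {m w v} → anc parent m w ≡ just v → depth w ≡ m + depth v
  depth-anc {m} {w} {v} e =
    ≤-antisym (anc-≤-root _ _ w-root e-root) (anc-≤-root _ _ e-root w-root)
    where
    w-root = proj₂ (reaches w)
    e-root = anc-+ m e (proj₂ (reaches v))

  depth-child : ∀ {u v} → parent v ≡ just u → depth v ≡ suc (depth u)
  depth-child pv = depth-anc {1} (anc-parent pv)

  subtree-self : ∀ {v} → InSubtree T v v
  subtree-self = 0 , refl

  subtree-child : ∀ {v w x} → parent x ≡ just w → InSubtree T v w → InSubtree T v x
  subtree-child px (m , e) = suc m , trans (anc-parent px) e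

  subtree-parent : ∀ {v w p} → InSubtree T v w → w ≢ v → parent w ≡ just p → InSubtree T v p
  subtree-parent (zero  , refl) w≢v _  = ⊥-elim (w≢v refl)
  subtree-parent (suc m , e)    _   pw = m , trans (sym (anc-parent pw)) e

  subtree-⊆-parent : ∀ {u v w} → parent v ≡ just u → InSubtree T v w → InSubtree T u w
  subtree-⊆-parent pv (m , e) = m + 1 , anc-+ m e (anc-parent pv)

  subtree-below-child : ∀ {u w} → InSubtree T u w → w ≢ u →
                        ∃ λ v → parent v ≡ just u × InSubtree T v w
  subtree-below-child (zero  , refl) w≢u = ⊥-elim (w≢u refl)
  subtree-below-child (suc m , e)    _   with anc-last m e
  ... | v , e' , pv = v , pv , m , e'

  parent∉subtree : ∀ {u v} → parent v ≡ just u → ¬ InSubtree T v u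
  parent∉subtree {u} pv (m , e) = 1+n≰n (subst (suc (depth u) ≤_) (sym depth-u) (m≤n+m _ m))
    where
    depth-u : depth u ≡ m + suc (depth u)
    depth-u = trans (depth-anc e) (cong (λ k → m + k) (depth-child pv))

  ≢-parent : ∀ {u v x} → parent v ≡ just u → InSubtree T v x → x ≢ u
  ≢-parent pv x∈ refl = parent∉subtree pv x∈

  siblings-disjoint : ∀ {u v v' x} → parent v ≡ just u → parent v' ≡ just u →
                      InSubtree T v x → InSubtree T v' x → v ≡ v'
  siblings-disjoint {u} {x = x} pv pv' (m , e) (m' , e') =
    just-injective (trans (sym e) (subst (λ i → anc parent i x ≡ just _) (sym m≡m') e'))
    where
    m≡m' : m ≡ m'
    m≡m' = +-cancelʳ-≡ (suc (depth u)) m m'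
      (trans (cong (λ k → m + k) (sym (depth-child pv)))
      (trans (sym (depth-anc e)) (trans (depth-anc e') (cong (λ k → m' + k) (depth-child pv')))))

  InSubtree? : ∀ v w → Dec (InSubtree T v w)
  InSubtree? v w =
    map′ (depth w ∸ depth v ,_) height (≡-decᵐ _≟_ (anc parent (depth w ∸ depth v) w) (just v))
    where
    height : InSubtree T v w → anc parent (depth w ∸ depth v) w ≡ just v
    height (m , e) = subst (λ i → anc parent i w ≡ just v)
                           (sym (trans (cong (_∸ depth v) (depth-anc e)) (m+n∸n≡m m (depth v)))) e

  isParentOf⇒parent : ∀ w {v} → isParentOf T w v ≡ true → parent w ≡ just v
  isParentOf⇒parent w {v} h with parent w
  isParentOf⇒parent w     ()  | nothing
  isParentOf⇒parent w {v} h   | just x with x ≟ v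
  isParentOf⇒parent w     h   | just x | yes refl = refl
  isParentOf⇒parent w     ()  | just x | no _

  parent⇒isParentOf : ∀ {w v} → parent w ≡ just v → isParentOf T w v ≡ true
  parent⇒isParentOf {v = v} pw rewrite pw = dec-true (v ≟ v) refl

  adj-to-child : ∀ {u v} → parent v ≡ just u → adj T u v ≡ true
  adj-to-child pv rewrite parent⇒isParentOf pv = refl

  adj-to-parent : ∀ {u v} → parent v ≡ just u → adj T v u ≡ true
  adj-to-parent pv rewrite parent⇒isParentOf pv = ∨-zeroʳ _

  adj-sym : ∀ a b → adj T a b ≡ adj T b a
  adj-sym a b = ∨-comm (isParentOf T b a) (isParentOf T a b)

  adj-leaving : ∀ {v w x} → InSubtree T v w → ¬ InSubtree T v x → adj T w x ≡ true →
                w ≡ v × parent v ≡ just x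
  adj-leaving {v} {w} {x} w∈ x∉ h with isParentOf T x w in e
  ... | true = ⊥-elim (x∉ (subtree-child (isParentOf⇒parent x e) w∈))
  ... | false with w ≟ v
  ...   | yes refl = refl , isParentOf⇒parent w h
  ...   | no w≢v   = ⊥-elim (x∉ (subtree-parent w∈ w≢v (isParentOf⇒parent w h)))

  ∈-children⁻ : ∀ {u v} → v ∈ children T u → parent v ≡ just u
  ∈-children⁻ {u} v∈ =
    isParentOf⇒parent _ (proj₂ (∈-filter⁻ (λ w → isParentOf T w u ≟ᵇ true) {xs = allFin n} v∈))

  ∈-children⁺ : ∀ {u v} → parent v ≡ just u → v ∈ children T u
  ∈-children⁺ {u} pv =
    ∈-filter⁺ (λ w → isParentOf T w u ≟ᵇ true) (∈-allFin _) (parent⇒isParentOf pv)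

  children-unique : ∀ u → Unique (children T u)
  children-unique u = Unique.filter⁺ (λ w → isParentOf T w u ≟ᵇ true) (Unique.allFin⁺ n)

module Firing {n : ℕ} (T : RootedTree n) where
  open RootedTree T
  open Tree T

  run : Config n → List (Fin n) → Config n
  run τ []       = τ
  run τ (w ∷ ws) = run (fire T τ w) ws

  Legal : Fin n → Config n → List (Fin n) → Set
  Legal v τ ws = Reach T v τ (run τ ws) ws

  Stabilizes : Fin n → Config n → List (Fin n) → Set
  Stabilizes v τ ws = FinalBy T v τ (run τ ws) ws

  reach-run : ∀ {v τ τ' ws} → Reach T v τ τ' ws → τ' ≡ run τ ws
  reach-run done         = refl
  reach-run (step _ _ r) = reach-run r

  terminal-reach : ∀ {v τ τ' ws} → LocalTerminal T τ v → Reach T v τ τ' ws → ws ≡ [] × τ' ≡ τ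
  terminal-reach st done             = refl , refl
  terminal-reach st (step w∈ full _) = ⊥-elim (<⇒≱ (st _ w∈) full)

  terminal-agree : ∀ {v τ ρ} → (∀ {x} → InSubtree T v x → τ x ≡ ρ x) →
                   LocalTerminal T τ v → LocalTerminal T ρ v
  terminal-agree agree st w w∈ = subst (_< deg T w) (agree w∈) (st w w∈)

  run-++ : ∀ τ xs ys → run τ (xs ++ ys) ≡ run (run τ xs) ys
  run-++ τ []       ys = refl
  run-++ τ (x ∷ xs) ys = run-++ (fire T τ x) xs ys

  reach-++ : ∀ {v τ τ' τ'' xs ys} → Reach T v τ τ' xs → Reach T v τ' τ'' ys →
             Reach T v τ τ'' (xs ++ ys)
  reach-++ done             r = r
  reach-++ (step w∈ full l) r = step w∈ full (reach-++ l r)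

  legal-++ : ∀ {v τ xs ys} → Legal v τ xs → Legal v (run τ xs) ys → Legal v τ (xs ++ ys)
  legal-++ {v} {τ} {xs} {ys} l₁ l₂ =
    subst (λ τ' → Reach T v τ τ' (xs ++ ys)) (sym (run-++ τ xs ys)) (reach-++ l₁ l₂)

  legal-⊆ : ∀ {u v τ ws} → (∀ {w} → InSubtree T v w → InSubtree T u w) →
            Legal v τ ws → Legal u τ ws
  legal-⊆ sub done             = done
  legal-⊆ sub (step w∈ full l) = step (sub w∈) full (legal-⊆ sub l)

  count-here : ∀ v ws → count T v (v ∷ ws) ≡ suc (count T v ws)
  count-here v ws = cong length (filter-accept (_≟ v) refl)

  count-there : ∀ {v w} ws → w ≢ v → count T v (w ∷ ws) ≡ count T v ws
  count-there {v} ws w≢v = cong length (filter-reject (_≟ v) w≢v)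

  count-++ : ∀ v xs ys → count T v (xs ++ ys) ≡ count T v xs + count T v ys
  count-++ v xs ys = trans (cong length (filter-++ (_≟ v) xs ys)) (length-++ (filter (_≟ v) xs))

  legal-count-outside : ∀ {v τ ws x} → Legal v τ ws → ¬ InSubtree T v x → count T x ws ≡ 0
  legal-count-outside done x∉ = refl
  legal-count-outside (step {ws = ws} w∈ _ l) x∉ =
    trans (count-there ws (λ w≡x → x∉ (subst (InSubtree T _) w≡x w∈))) (legal-count-outside l x∉)

  fire-self : ∀ τ w → fire T τ w w ≡ τ w ∸ deg T w
  fire-self τ w rewrite dec-true (w ≟ w) refl = refl

  fire-other : ∀ τ w {x} → x ≢ w → fire T τ w x ≡ (if adj T w x then suc (τ x) else τ x)
  fire-other τ w {x} x≢w rewrite dec-false (x ≟ w) x≢w = refl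

  fire-cong : ∀ {τ ρ} w x → τ x ≡ ρ x → fire T τ w x ≡ fire T ρ w x
  fire-cong w x eq with does (x ≟ w)
  ... | true  = cong (_∸ deg T w) eq
  ... | false = cong (λ t → if adj T w x then suc t else t) eq

  fire-+ : ∀ {τ ρ} (e : Config n) w → Full T τ w → (∀ x → ρ x ≡ τ x + e x) →
           ∀ x → fire T ρ w x ≡ fire T τ w x + e x
  fire-+ e w full eq x with x ≟ w
  ... | yes refl = trans (cong (_∸ deg T w) (eq w)) (+-∸-comm (e w) full)
  ... | no _ with adj T w x
  ...   | true  = cong suc (eq x)
  ...   | false = eq x

  fire-mono : ∀ τ {a b} → a ≢ b → τ a ≤ fire T τ b a
  fire-mono τ {a} {b} a≢b rewrite fire-other τ b a≢b with adj T b a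
  ... | true  = n≤1+n _
  ... | false = ≤-refl

  fire-comm-at : ∀ τ {a b} → a ≢ b → Full T τ a →
                 fire T (fire T τ b) a a ≡ fire T (fire T τ a) b a
  fire-comm-at τ {a} {b} a≢b full
    rewrite fire-self (fire T τ b) a | fire-other (fire T τ a) b a≢b
          | fire-other τ b a≢b       | fire-self τ a
    with adj T b a
  ... | true  = +-∸-assoc 1 full
  ... | false = refl

  fire-comm-away : ∀ τ {a b x} → x ≢ a → x ≢ b →
                   fire T (fire T τ b) a x ≡ fire T (fire T τ a) b x
  fire-comm-away τ {a} {b} {x} x≢a x≢b
    rewrite fire-other (fire T τ b) a x≢a | fire-other (fire T τ a) b x≢b
          | fire-other τ a x≢a            | fire-other τ b x≢b
    with adj T a x | adj T b x
  ... | true  | true  = refl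
  ... | true  | false = refl
  ... | false | _     = refl

  fire-comm : ∀ τ {a b} → a ≢ b → Full T τ a → Full T τ b →
              fire T (fire T τ b) a ≗ fire T (fire T τ a) b
  fire-comm τ {a} {b} a≢b fa fb x = by-cases (x ≟ a) (x ≟ b)
    where
    by-cases : Dec (x ≡ a) → Dec (x ≡ b) → fire T (fire T τ b) a x ≡ fire T (fire T τ a) b x
    by-cases (yes refl) _          = fire-comm-at τ a≢b fa
    by-cases (no _)     (yes refl) = sym (fire-comm-at τ (a≢b ∘ sym) fb)
    by-cases (no x≢a)   (no x≢b)   = fire-comm-away τ x≢a x≢b

  legal-transfer : ∀ {v τ ρ ws} (P : Fin n → Set) → (∀ {w} → InSubtree T v w → P w) →
                   (∀ {x} → P x → τ x ≡ ρ x) → Legal v τ ws →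
                   Legal v ρ ws × (∀ {x} → P x → run τ ws x ≡ run ρ ws x)
  legal-transfer P sub agree done = done , agree
  legal-transfer P sub agree (step w∈ full l)
    with legal-transfer P sub (λ {x} px → fire-cong _ x (agree px)) l
  ... | l' , agree' = step w∈ (subst (deg T _ ≤_) (agree (sub w∈)) full) l' , agree'

  legal-≗ : ∀ {v τ ρ ws} → τ ≗ ρ → Legal v τ ws → Legal v ρ ws × run τ ws ≗ run ρ ws
  legal-≗ eq l with legal-transfer (λ _ → ⊤) (λ _ → tt) (λ {x} _ → eq x) l
  ... | l' , agree = l' , λ x → agree tt

  legal-+ : ∀ {v τ ρ ws} (e : Config n) → (∀ x → ρ x ≡ τ x + e x) → Legal v τ ws →
            Legal v ρ ws × (∀ x → run ρ ws x ≡ run τ ws x + e x)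
  legal-+ e eq done = done , eq
  legal-+ {τ = τ} e eq (step {w = w} w∈ full l) with legal-+ e (fire-+ e _ full eq) l
  ... | l' , eq' = step w∈ (≤-trans full (subst (τ w ≤_) (sym (eq w)) (m≤m+n _ _))) l' , eq'

  -- A full vertex of the subtree stays full until it fires, so it occurs in every stabilizing
  -- sequence; since firings of full vertices commute, it can be moved to the front.
  least-action-step : ∀ {v τ a β} → InSubtree T v a → Full T τ a → Legal v τ β →
                      LocalTerminal T (run τ β) v →
                      ∃ λ β' → Legal v (fire T τ a) β' × run (fire T τ a) β' ≗ run τ β ×
                               suc (length β') ≡ length β
  least-action-step a∈ fa done st = ⊥-elim (<⇒≱ (st _ a∈) fa)
  least-action-step {τ = τ} {a} a∈ fa (step {w = b} {ws = bs} b∈ fb l) st with a ≟ b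
  ... | yes refl = bs , l , (λ _ → refl) , refl
  ... | no a≢b with least-action-step a∈ (≤-trans fa (fire-mono τ a≢b)) l st
  ...   | β' , l' , same , len with legal-≗ (fire-comm τ a≢b fa fb) l'
  ...     | l'' , same' =
    b ∷ β' , step b∈ (≤-trans fb (fire-mono τ (a≢b ∘ sym))) l'' ,
    (λ x → trans (sym (same' x)) (same x)) , cong suc len

  least-action : ∀ {v τ α β} → Legal v τ α → Legal v τ β → LocalTerminal T (run τ β) v →
                 ∃ λ γ → Legal v (run τ α) γ × run (run τ α) γ ≗ run τ β ×
                         length α + length γ ≡ length β
  least-action {β = β} done lβ st = β , lβ , (λ _ → refl) , refl
  least-action (step a∈ fa lα) lβ st with least-action-step a∈ fa lβ st
  ... | β' , lβ' , same , len
    with least-action lα lβ' (terminal-agree (λ {x} _ → sym (same x)) st)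
  ...   | γ , lγ , same' , len' =
    γ , lγ , (λ x → trans (same' x) (same x)) , trans (cong suc len') len

  stabilize-bounded : ∀ v f τ → (∀ α → Legal v τ α → length α ≤ f) → ∃ λ α → Stabilizes v τ α
  stabilize-bounded v f τ bound with any? (λ w → InSubtree? v w ×-dec (deg T w ≤? τ w))
  ... | no none = [] , done , λ w w∈ → ≰⇒> (λ full → none (w , w∈ , full))
  stabilize-bounded v zero τ bound | yes (w , w∈ , full) =
    ⊥-elim (1+n≰n (bound (w ∷ []) (step w∈ full done)))
  stabilize-bounded v (suc f) τ bound | yes (w , w∈ , full)
    with stabilize-bounded v f (fire T τ w) (λ α l → ≤-pred (bound (w ∷ α) (step w∈ full l)))
  ... | α , l , st = w ∷ α , step w∈ full l , st

  -- Adding chips keeps legal sequences legal, so by least action no legal sequence from τ is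
  -- longer than β, and greedy firing from τ terminates.
  stabilizes-below : ∀ {v τ ρ β} (e : Config n) → (∀ x → ρ x ≡ τ x + e x) → Stabilizes v ρ β →
                     ∃ λ α → Stabilizes v τ α
  stabilizes-below {v} {τ} {β = β} e eq (lβ , st) = stabilize-bounded v (length β) τ bound
    where
    bound : ∀ α → Legal v τ α → length α ≤ length β
    bound α l with least-action (proj₁ (legal-+ e eq l)) lβ st
    ... | _ , _ , _ , len = subst (length α ≤_) len (m≤m+n _ _)

  module _ {u v : Fin n} (pv : parent v ≡ just u) where
    open ≡-Reasoning

    fire-outside : ∀ τ {w x} → InSubtree T v w → ¬ InSubtree T v x → x ≢ u → fire T τ w x ≡ τ x
    fire-outside τ {w} {x} w∈ x∉ x≢u
      rewrite fire-other τ w {x} (λ x≡w → x∉ (subst (InSubtree T v) (sym x≡w) w∈))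
      with adj T w x in h
    ... | true  = ⊥-elim (x≢u (just-injective (trans (sym (proj₂ (adj-leaving w∈ x∉ h))) pv)))
    ... | false = refl

    legal-run-outside : ∀ {τ ws x} → Legal v τ ws → ¬ InSubtree T v x → x ≢ u →
                        run τ ws x ≡ τ x
    legal-run-outside done _ _ = refl
    legal-run-outside {τ} (step w∈ _ l) x∉ x≢u =
      trans (legal-run-outside l x∉ x≢u) (fire-outside τ w∈ x∉ x≢u)

    fire-at-parent : ∀ τ {w} → InSubtree T v w → fire T τ w u ≡ τ u + count T v (w ∷ [])
    fire-at-parent τ {w} w∈ rewrite fire-other τ w {u} (≢-parent pv w∈ ∘ sym) with w ≟ v
    ... | yes refl rewrite adj-to-parent pv = +-comm 1 (τ u)
    ... | no w≢v with adj T w u in h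
    ...   | true  = ⊥-elim (w≢v (proj₁ (adj-leaving w∈ (parent∉subtree pv) h)))
    ...   | false = sym (+-identityʳ (τ u))

    legal-run-parent : ∀ {τ ws} → Legal v τ ws → run τ ws u ≡ τ u + count T v ws
    legal-run-parent {τ} done = sym (+-identityʳ (τ u))
    legal-run-parent {τ} (step {w = w} {ws = ws} w∈ _ l) = begin
      run (fire T τ w) ws u                      ≡⟨ legal-run-parent l ⟩
      fire T τ w u + count T v ws                ≡⟨ cong (_+ count T v ws) (fire-at-parent τ w∈) ⟩
      τ u + count T v (w ∷ []) + count T v ws    ≡⟨ +-assoc (τ u) _ _ ⟩
      τ u + (count T v (w ∷ []) + count T v ws)  ≡⟨ cong (λ c → τ u + c) (count-++ v (w ∷ []) ws) ⟨
      τ u + count T v (w ∷ ws)                   ∎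

  legal-sibling : ∀ {u v v' τ β γ} → parent v ≡ just u → parent v' ≡ just u → v ≢ v' →
                  Legal v τ β → Legal v' τ γ →
                  Legal v' (run τ β) γ ×
                  (∀ {x} → InSubtree T v' x → run (run τ β) γ x ≡ run τ γ x)
  legal-sibling {v' = v'} {τ} {β} pv pv' v≢v' lβ lγ =
    map₂ (λ agree x∈ → sym (agree x∈)) (legal-transfer (InSubtree T v') id unchanged lγ)
    where
    unchanged : ∀ {x} → InSubtree T v' x → τ x ≡ run τ β x
    unchanged x∈ = sym (legal-run-outside pv lβ (λ x∈v → v≢v' (siblings-disjoint pv pv' x∈v x∈))
                                              (≢-parent pv' x∈))

module Delta {n : ℕ} (T : RootedTree n) where
  open RootedTree T
  open Tree T
  open Firing T
  open ≡-Reasoning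

  chipsAt : Fin n → ℕ → Config n
  chipsAt v c = addAt T (λ _ → 0) c v

  addAt-chipsAt : ∀ τ c v x → addAt T τ c v x ≡ τ x + chipsAt v c x
  addAt-chipsAt τ c v x with does (x ≟ v)
  ... | true  = refl
  ... | false = sym (+-identityʳ (τ x))

  addAt-suc : ∀ τ c v x → addAt T τ (suc c) v x ≡ addAt T τ 1 v x + chipsAt v c x
  addAt-suc τ c v x with does (x ≟ v)
  ... | true  = sym (+-assoc (τ x) 1 c)
  ... | false = sym (+-identityʳ (τ x))

  addAt-zero : ∀ τ v x → addAt T τ 0 v x ≡ τ x
  addAt-zero τ v x with does (x ≟ v)
  ... | true  = +-identityʳ (τ x)
  ... | false = refl

  addAt-self : ∀ τ c v → addAt T τ c v v ≡ τ v + c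
  addAt-self τ c v rewrite dec-true (v ≟ v) refl = refl

  addAt-other : ∀ τ c {v x} → x ≢ v → addAt T τ c v x ≡ τ x
  addAt-other τ c {v} {x} x≢v rewrite dec-false (x ≟ v) x≢v = refl

  gain-at-parent : ∀ {u v σ x β} → parent v ≡ just u → Legal v (addAt T σ x v) β →
                   + run (addAt T σ x v) β u ℤ.- + σ u ≡ + count T v β
  gain-at-parent {u} {v} {σ} {x} {β} pv l = begin
    + run (addAt T σ x v) β u ℤ.- + σ u
      ≡⟨ cong (λ t → + t ℤ.- + σ u) (legal-run-parent pv l) ⟩
    + (addAt T σ x v u + count T v β) ℤ.- + σ u
      ≡⟨ cong (λ t → + (t + count T v β) ℤ.- + σ u) (addAt-other σ x u≢v) ⟩
    + (σ u + count T v β) ℤ.- + σ u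
      ≡⟨ +[m+n]-+m≡+n (σ u) (count T v β) ⟩
    + count T v β
      ∎
    where
    u≢v : u ≢ v
    u≢v = ≢-parent pv subtree-self ∘ sym

  delta⇒stabilizes : ∀ {u v σ x d} → parent v ≡ just u → LocalTerminal T σ v →
                     DeltaIs T σ v x d → ∃ λ β → Stabilizes v (addAt T σ x v) β × d ≡ + count T v β
  delta⇒stabilizes pv σ-term (_ , pp , _ , _ , (β , r₁ , st₁) , (_ , r₀ , _) , d≡)
    with refl ← just-injective (trans (sym pp) pv)
       | _ , refl ← terminal-reach σ-term r₀
       | refl ← reach-run r₁
    = β , (r₁ , st₁) , trans d≡ (gain-at-parent pv r₁)

  stabilizes⇒delta : ∀ {u v σ x β} → parent v ≡ just u → LocalTerminal T σ v →
                     Stabilizes v (addAt T σ x v) β → DeltaIs T σ v x (+ count T v β)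
  stabilizes⇒delta pv σ-term s =
    _ , pv , _ , _ , (_ , s) , ([] , done , σ-term) , sym (gain-at-parent pv (proj₁ s))

  deltaSum-lookup : ∀ {σ x ds s v} → DeltaSumIs T σ x ds s → v ∈ ds → ∃ λ d → DeltaIs T σ v x d
  deltaSum-lookup (cons δ _)    (here refl) = _ , δ
  deltaSum-lookup (cons _ δs)   (there v∈)  = deltaSum-lookup δs v∈

  module _ {u v : Fin n} {σ : Config n} (pv : parent v ≡ just u) (σ-term : LocalTerminal T σ v)
    where

    addAt-zero-terminal : LocalTerminal T (addAt T σ 0 v) v
    addAt-zero-terminal = terminal-agree (λ {x} _ → sym (addAt-zero σ v x)) σ-term

    delta-zero : ∀ {d} → DeltaIs T σ v 0 d → d ≡ + 0
    delta-zero δ with delta⇒stabilizes pv σ-term δ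
    ... | _ , (r , _) , d≡ with refl , _ ← terminal-reach addAt-zero-terminal r = d≡

    delta-zero-exists : DeltaIs T σ v 0 (+ 0)
    delta-zero-exists = stabilizes⇒delta pv σ-term (done , addAt-zero-terminal)

  module Shift {u v : Fin n} {σ σ' : Config n} {A : List (Fin n)}
               (pv : parent v ≡ just u) (σ-term : LocalTerminal T σ v)
               (hA : Stabilizes v (addAt T σ 1 v) A)
               (agree : ∀ {x} → InSubtree T v x → σ' x ≡ run (addAt T σ 1 v) A x) (j : ℕ) where

    ρ : Config n
    ρ = addAt T σ (suc j) v

    lifted : Legal v ρ A × (∀ x → run ρ A x ≡ run (addAt T σ 1 v) A x + chipsAt v j x)
    lifted = legal-+ (chipsAt v j) (addAt-suc σ j v) (proj₁ hA)

    after-A : ∀ {x} → InSubtree T v x → run ρ A x ≡ addAt T σ' j v x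
    after-A {x} x∈ = begin
      run ρ A x                                ≡⟨ proj₂ lifted x ⟩
      run (addAt T σ 1 v) A x + chipsAt v j x  ≡⟨ cong (_+ chipsAt v j x) (agree x∈) ⟨
      σ' x + chipsAt v j x                     ≡⟨ addAt-chipsAt σ' j v x ⟨
      addAt T σ' j v x                         ∎

    σ'-terminal : LocalTerminal T σ' v
    σ'-terminal = terminal-agree (sym ∘ agree) (proj₂ hA)

    stabilizes-shift→ : ∀ {β} → Stabilizes v (addAt T σ' j v) β → Stabilizes v ρ (A ++ β)
    stabilizes-shift→ {β} (lβ , st) with legal-transfer (InSubtree T v) id (sym ∘ after-A) lβ
    ... | lβ' , same = legal-++ (proj₁ lifted) lβ' , terminal-agree after-β st
      where
      after-β : ∀ {x} → InSubtree T v x → run (addAt T σ' j v) β x ≡ run ρ (A ++ β) x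
      after-β {x} x∈ = trans (same x∈) (sym (cong-app (run-++ ρ A β) x))

    stabilizes-shift← : ∀ {β} → Stabilizes v ρ β →
                        ∃ λ γ → Stabilizes v (addAt T σ' j v) γ ×
                                count T v β ≡ count T v A + count T v γ
    stabilizes-shift← {β} (lβ , st) with least-action (proj₁ lifted) lβ st
    ... | γ , lγ , same , _ with legal-transfer (InSubtree T v) id after-A lγ
    ...   | lγ' , same' =
      γ , (lγ' , terminal-agree (λ x∈ → trans (sym (same _)) (same' x∈)) st) , counts
      where
      counts : count T v β ≡ count T v A + count T v γ
      counts = +-cancelˡ-≡ (ρ u) _ _ (begin
        ρ u + count T v β                  ≡⟨ legal-run-parent pv lβ ⟨
        run ρ β u                          ≡⟨ same u ⟨
        run (run ρ A) γ u                  ≡⟨ legal-run-parent pv lγ ⟩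
        run ρ A u + count T v γ
          ≡⟨ cong (_+ count T v γ) (legal-run-parent pv (proj₁ lifted)) ⟩
        ρ u + count T v A + count T v γ    ≡⟨ +-assoc (ρ u) _ _ ⟩
        ρ u + (count T v A + count T v γ)  ∎)

    delta-shift→ : ∀ {d} → DeltaIs T σ' v j d → DeltaIs T σ v (suc j) (+ count T v A ℤ.+ d)
    delta-shift→ δ with delta⇒stabilizes pv σ'-terminal δ
    ... | β , s , refl =
      subst (DeltaIs T σ v (suc j))
            (trans (cong +_ (count-++ v A β)) (pos-+ (count T v A) (count T v β)))
            (stabilizes⇒delta pv σ-term (stabilizes-shift→ s))

    delta-shift← : ∀ {d} → DeltaIs T σ v (suc j) d →
                   ∃ λ d' → DeltaIs T σ' v j d' × d ≡ + count T v A ℤ.+ d'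
    delta-shift← δ with delta⇒stabilizes pv σ-term δ
    ... | β , s , refl with stabilizes-shift← s
    ...   | γ , s' , counts =
      + count T v γ , stabilizes⇒delta pv σ'-terminal s' ,
      trans (cong +_ counts) (pos-+ (count T v A) (count T v γ))

module SiblingRuns {n : ℕ} (T : RootedTree n) (u : Fin n) (α : Fin n → List (Fin n)) where
  open RootedTree T
  open Tree T
  open Firing T
  open ≡-Reasoning

  record Siblings (ds : List (Fin n)) (τ : Config n) : Set where
    field
      distinct : Unique ds
      parents  : ∀ {v} → v ∈ ds → parent v ≡ just u
      legal    : ∀ {v} → v ∈ ds → Legal v τ (α v)

  open Siblings

  fired : List (Fin n) → ℕ
  fired ds = sum (map (λ v → count T v (α v)) ds)

  head-parent : ∀ {v ds τ} → Siblings (v ∷ ds) τ → parent v ≡ just u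
  head-parent s = parents s (here refl)

  head-legal : ∀ {v ds τ} → Siblings (v ∷ ds) τ → Legal v τ (α v)
  head-legal s = legal s (here refl)

  after-head : ∀ {v ds τ} (s : Siblings (v ∷ ds) τ) {v'} → v' ∈ ds →
               Legal v' (run τ (α v)) (α v') ×
               (∀ {x} → InSubtree T v' x → run (run τ (α v)) (α v') x ≡ run τ (α v') x)
  after-head s m = legal-sibling (head-parent s) (parents s (there m))
                                 (All.lookup (AllPairs.head (distinct s)) m)
                                 (head-legal s) (legal s (there m))

  siblings-tail : ∀ {v ds τ} → Siblings (v ∷ ds) τ → Siblings ds (run τ (α v))
  siblings-tail s = record
    { distinct = AllPairs.tail (distinct s)
    ; parents  = parents s ∘ there
    ; legal    = proj₁ ∘ after-head s
    }

  concat-legal : ∀ {ds τ} → Siblings ds τ → Legal u τ (concatMap α ds)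
  concat-legal {[]}     s = done
  concat-legal {v ∷ ds} s =
    legal-++ (legal-⊆ (subtree-⊆-parent (head-parent s)) (head-legal s))
             (concat-legal (siblings-tail s))

  concat-count : ∀ {ds τ} → Siblings ds τ → count T u (concatMap α ds) ≡ 0
  concat-count {[]}     s = refl
  concat-count {v ∷ ds} s = trans (count-++ u (α v) (concatMap α ds))
    (cong₂ _+_ (legal-count-outside (head-legal s) (parent∉subtree (head-parent s)))
               (concat-count (siblings-tail s)))

  concat-parent : ∀ {ds τ} → Siblings ds τ → run τ (concatMap α ds) u ≡ τ u + fired ds
  concat-parent {[]}     {τ} s = sym (+-identityʳ (τ u))
  concat-parent {v ∷ ds} {τ} s = begin
    run τ (α v ++ concatMap α ds) u       ≡⟨ cong-app (run-++ τ (α v) _) u ⟩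
    run (run τ (α v)) (concatMap α ds) u  ≡⟨ concat-parent (siblings-tail s) ⟩
    run τ (α v) u + fired ds
      ≡⟨ cong (_+ fired ds) (legal-run-parent (head-parent s) (head-legal s)) ⟩
    τ u + count T v (α v) + fired ds      ≡⟨ +-assoc (τ u) _ _ ⟩
    τ u + fired (v ∷ ds)                  ∎

  concat-outside : ∀ {ds τ x} → Siblings ds τ → x ≢ u → (∀ {v} → v ∈ ds → ¬ InSubtree T v x) →
                   run τ (concatMap α ds) x ≡ τ x
  concat-outside {[]}             s _   _  = refl
  concat-outside {v ∷ ds} {τ} {x} s x≢u x∉ = begin
    run τ (α v ++ concatMap α ds) x       ≡⟨ cong-app (run-++ τ (α v) _) x ⟩
    run (run τ (α v)) (concatMap α ds) x  ≡⟨ concat-outside (siblings-tail s) x≢u (x∉ ∘ there) ⟩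
    run τ (α v) x
      ≡⟨ legal-run-outside (head-parent s) (head-legal s) (x∉ (here refl)) x≢u ⟩
    τ x                                   ∎

  concat-inside : ∀ {ds τ v x} → Siblings ds τ → v ∈ ds → InSubtree T v x →
                  run τ (concatMap α ds) x ≡ run τ (α v) x
  concat-inside {v ∷ ds} {τ} {x = x} s (here refl) x∈ = begin
    run τ (α v ++ concatMap α ds) x       ≡⟨ cong-app (run-++ τ (α v) _) x ⟩
    run (run τ (α v)) (concatMap α ds) x
      ≡⟨ concat-outside (siblings-tail s) (≢-parent (head-parent s) x∈) elsewhere ⟩
    run τ (α v) x                         ∎
    where
    elsewhere : ∀ {v'} → v' ∈ ds → ¬ InSubtree T v' x
    elsewhere m x∈' = All.lookup (AllPairs.head (distinct s)) m
                                 (siblings-disjoint (head-parent s) (parents s (there m)) x∈ x∈')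
  concat-inside {v ∷ ds} {τ} {v'} {x} s (there m) x∈ = begin
    run τ (α v ++ concatMap α ds) x       ≡⟨ cong-app (run-++ τ (α v) _) x ⟩
    run (run τ (α v)) (concatMap α ds) x  ≡⟨ concat-inside (siblings-tail s) m x∈ ⟩
    run (run τ (α v)) (α v') x            ≡⟨ proj₂ (after-head s m) x∈ ⟩
    run τ (α v') x                        ∎

module ChildrenStable {n : ℕ} (T : RootedTree n) (u : Fin n) (σ : Config n)
                      (terminal : ∀ v → v ∈ children T u → LocalTerminal T σ v) where
  open RootedTree T
  open Tree T
  open Firing T
  open Delta T

  D : ℕ
  D = deg T u

  terminal-below : ∀ {v} → parent v ≡ just u → LocalTerminal T σ v
  terminal-below pv = terminal _ (∈-children⁺ pv)

  deltaSum-zero : ∀ {ds s} → (∀ {v} → v ∈ ds → v ∈ children T u) → DeltaSumIs T σ 0 ds s → s ≡ + 0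
  deltaSum-zero sub nil = refl
  deltaSum-zero sub (cons δ δs) =
    cong₂ ℤ._+_ (delta-zero pv (terminal-below pv) δ) (deltaSum-zero (sub ∘ there) δs)
    where pv = ∈-children⁻ (sub (here refl))

  deltaSum-zero-exists : ∀ ds → (∀ {v} → v ∈ ds → v ∈ children T u) → DeltaSumIs T σ 0 ds (+ 0)
  deltaSum-zero-exists []       sub = nil
  deltaSum-zero-exists (v ∷ ds) sub =
    cons (delta-zero-exists pv (terminal-below pv)) (deltaSum-zero-exists ds (sub ∘ there))
    where pv = ∈-children⁻ (sub (here refl))

  psi-formula-zero : + σ u ℤ.- + (0 * D) ℤ.+ + 0 ≡ + σ u
  psi-formula-zero = cong +_ (trans (+-identityʳ (σ u + 0)) (+-identityʳ (σ u)))

  psi-zero : ∀ {p} → PsiIs T σ u 0 p → p ≡ + σ u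
  psi-zero (s , δs , p≡) rewrite deltaSum-zero id δs = trans p≡ psi-formula-zero

  psi-zero-exists : PsiIs T σ u 0 (+ σ u)
  psi-zero-exists = + 0 , deltaSum-zero-exists _ id , sym psi-formula-zero

  subtree-terminal : σ u < D → LocalTerminal T σ u
  subtree-terminal σu<D w w∈ with w ≟ u
  ... | yes refl = σu<D
  ... | no w≢u with subtree-below-child w∈ w≢u
  ...   | v , pv , w∈v = terminal-below pv w w∈v

  no-firing : ∀ {p} → PsiIs T σ u 0 p → p ℤ.< + D → CDownIs T σ u 0
  no-firing ψ p<D =
    σ , [] , (done , subtree-terminal (drop‿+<+ (subst (ℤ._< + D) (psi-zero ψ) p<D))) , refl

  root-full : (∀ p → PsiIs T σ u 0 p → ¬ (p ℤ.< + D)) → Full T σ u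
  root-full ψ≮ = ≮⇒≥ (λ σu<D → ψ≮ (+ σ u) psi-zero-exists (+<+ σu<D))

  child-stabilizers : ∀ {k p} → PsiIs T σ u (suc k) p →
                      ∃ λ α → ∀ {v} → parent v ≡ just u → Stabilizes v (addAt T σ 1 v) (α v)
  child-stabilizers {k} (_ , δs , _) =
    decidable-choice (λ v → Stabilizes v (addAt T σ 1 v)) []
                     (λ v → ≡-decᵐ _≟_ (parent v) (just u)) stabilizer
    where
    stabilizer : ∀ {v} → parent v ≡ just u → ∃ (Stabilizes v (addAt T σ 1 v))
    stabilizer {v} pv with deltaSum-lookup δs (∈-children⁺ pv)
    ... | _ , δ with delta⇒stabilizes pv (terminal-below pv) δ
    ...   | _ , s , _ = stabilizes-below (chipsAt v k) (addAt-suc σ k v) s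

module RootFiring {n : ℕ} (T : RootedTree n) (u : Fin n) (σ : Config n)
                  (terminal : ∀ v → v ∈ children T u → LocalTerminal T σ v) (full : Full T σ u)
                  (α : Fin n → List (Fin n))
                  (stabilizers : ∀ {v} → RootedTree.parent T v ≡ just u →
                                 Firing.Stabilizes T v (addAt T σ 1 v) (α v)) where
  open RootedTree T
  open Tree T
  open Firing T
  open Delta T
  open SiblingRuns T u α
  open ≡-Reasoning

  D : ℕ
  D = deg T u

  fire-root-agrees : ∀ {v x} → parent v ≡ just u → InSubtree T v x →
                     fire T σ u x ≡ addAt T σ 1 v x
  fire-root-agrees {v} {x} pv x∈ = trans (fire-other σ u (≢-parent pv x∈)) (by-cases (x ≟ v))
    where
    by-cases : Dec (x ≡ v) → (if adj T u x then suc (σ x) else σ x) ≡ addAt T σ 1 v x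
    by-cases (yes refl) rewrite adj-to-child pv = trans (+-comm 1 (σ x)) (sym (addAt-self σ 1 x))
    by-cases (no x≢v) with adj T u x in h
    ... | true  = ⊥-elim (x≢v (proj₁ (adj-leaving x∈ (parent∉subtree pv) (trans (adj-sym x u) h))))
    ... | false = sym (addAt-other σ 1 x≢v)

  after-root : ∀ {v} → parent v ≡ just u →
               Legal v (fire T σ u) (α v) ×
               (∀ {x} → InSubtree T v x → run (addAt T σ 1 v) (α v) x ≡ run (fire T σ u) (α v) x)
  after-root pv =
    legal-transfer (InSubtree T _) id (sym ∘ fire-root-agrees pv) (proj₁ (stabilizers pv))

  siblings : Siblings (children T u) (fire T σ u)
  siblings = record
    { distinct = children-unique u
    ; parents  = ∈-children⁻
    ; legal    = proj₁ ∘ after-root ∘ ∈-children⁻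
    }

  σ' : Config n
  σ' = run (fire T σ u) (concatMap α (children T u))

  σ'-child : ∀ {v x} (v∈ : v ∈ children T u) → InSubtree T v x →
             σ' x ≡ run (addAt T σ 1 v) (α v) x
  σ'-child v∈ x∈ =
    trans (concat-inside siblings v∈ x∈) (sym (proj₂ (after-root (∈-children⁻ v∈)) x∈))

  σ'-terminal : ∀ v → v ∈ children T u → LocalTerminal T σ' v
  σ'-terminal v v∈ = terminal-agree (sym ∘ σ'-child v∈) (proj₂ (stabilizers (∈-children⁻ v∈)))

  σ'-root : σ' u ≡ σ u ∸ D + fired (children T u)
  σ'-root = trans (concat-parent siblings) (cong (_+ fired (children T u)) (fire-self σ u))

  cdown-step : ∀ {k} → CDownIs T σ' u k → CDownIs T σ u (suc k)
  cdown-step {k} (τ , ws , (r , st) , count≡k) =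
    τ , u ∷ concatMap α (children T u) ++ ws ,
    (step subtree-self full (reach-++ (concat-legal siblings) r) , st) , count≡
    where
    count≡ : count T u (u ∷ concatMap α (children T u) ++ ws) ≡ suc k
    count≡ = trans (count-here u _) (cong suc
      (trans (count-++ u (concatMap α (children T u)) ws)
             (cong₂ _+_ (concat-count siblings) count≡k)))

  module ChildShift {v : Fin n} (v∈ : v ∈ children T u) =
    Shift (∈-children⁻ v∈) (terminal v v∈) (stabilizers (∈-children⁻ v∈)) (σ'-child v∈)

  deltaSum-shift→ : ∀ {j ds s} → (∀ {v} → v ∈ ds → v ∈ children T u) →
                    DeltaSumIs T σ' j ds s → DeltaSumIs T σ (suc j) ds (+ fired ds ℤ.+ s)
  deltaSum-shift→ sub nil = nil
  deltaSum-shift→ {j} {v ∷ ds} sub (cons {d = d} {s = s} δ δs) =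
    subst (DeltaSumIs T σ (suc j) (v ∷ ds)) (+-regroup (count T v (α v)) (fired ds) d s)
      (cons (ChildShift.delta-shift→ (sub (here refl)) j δ) (deltaSum-shift→ (sub ∘ there) δs))

  deltaSum-shift← : ∀ {j ds s} → (∀ {v} → v ∈ ds → v ∈ children T u) →
                    DeltaSumIs T σ (suc j) ds s →
                    ∃ λ s' → DeltaSumIs T σ' j ds s' × s ≡ + fired ds ℤ.+ s'
  deltaSum-shift← sub nil = + 0 , nil , refl
  deltaSum-shift← {j} {v ∷ ds} sub (cons δ δs)
    with ChildShift.delta-shift← (sub (here refl)) j δ | deltaSum-shift← (sub ∘ there) δs
  ... | d' , δ' , refl | s' , δs' , refl =
    d' ℤ.+ s' , cons δ' δs' , +-regroup (count T v (α v)) (fired ds) d' s'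

  psi-step : ∀ j s → + σ' u ℤ.- + (j * D) ℤ.+ s ≡
                     + σ u ℤ.- + (suc j * D) ℤ.+ (+ fired (children T u) ℤ.+ s)
  psi-step j s = begin
    + σ' u ℤ.- + (j * D) ℤ.+ s
      ≡⟨ cong (λ t → + t ℤ.- + (j * D) ℤ.+ s) σ'-root ⟩
    + (σ u ∸ D + C) ℤ.- + (j * D) ℤ.+ s
      ≡⟨ psi-regroup (σ u ∸ D) C D (j * D) s ⟩
    + (D + (σ u ∸ D)) ℤ.- + (suc j * D) ℤ.+ (+ C ℤ.+ s)
      ≡⟨ cong (λ t → + t ℤ.- + (suc j * D) ℤ.+ (+ C ℤ.+ s)) (m+[n∸m]≡n full) ⟩
    + σ u ℤ.- + (suc j * D) ℤ.+ (+ C ℤ.+ s)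
      ∎
    where C = fired (children T u)

  psi-shift→ : ∀ {j p} → PsiIs T σ' u j p → PsiIs T σ u (suc j) p
  psi-shift→ {j} (s , δs , p≡) = _ , deltaSum-shift→ id δs , trans p≡ (psi-step j s)

  psi-shift← : ∀ {j p} → PsiIs T σ u (suc j) p → PsiIs T σ' u j p
  psi-shift← {j} (s , δs , p≡) with deltaSum-shift← id δs
  ... | s' , δs' , refl = s' , δs' , trans p≡ (sym (psi-step j s'))

lemma3p6 : ∀ {n} (T : RootedTree n) (u : Fin n) (σ : Config n) (k : ℕ) →
    (∀ v → v ∈ children T u → LocalTerminal T σ v) →
    (∃ λ p → PsiIs T σ u k p × p ℤ.< + deg T u) →
    (∀ j → j < k → ∀ p → PsiIs T σ u j p → ¬ (p ℤ.< + deg T u)) →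
    CDownIs T σ u k
lemma3p6 T u σ zero terminal (_ , ψ , p<D) _ = no-firing ψ p<D
  where open ChildrenStable T u σ terminal
lemma3p6 T u σ (suc k) terminal (p , ψ , p<D) minimal =
  cdown-step (lemma3p6 T u σ' k σ'-terminal (p , psi-shift← ψ , p<D)
                       (λ j j<k q ψ' → minimal (suc j) (s≤s j<k) q (psi-shift→ ψ')))
  where
  open ChildrenStable T u σ terminal
  open RootFiring T u σ terminal (root-full (minimal 0 (s≤s z≤n)))
                  (proj₁ (child-stabilizers ψ)) (proj₂ (child-stabilizers ψ))
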